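{- For any connected graph $G$, $pd_s(G)\le dim_s(G)+1$.
   Context: All graphs are finite, simple and connected; $d_G(x,y)$ is the shortest-path distance. A vertex $v$ strongly resolves two different vertices $x,y$ if $d_G(x,v)=d_G(x,y)+d_G(y,v)$ or $d_G(y,v)=d_G(y,x)+d_G(x,v)$. A set $S\subseteq V(G)$ is a strong resolving set if every two vertices of $G$ are strongly resolved by some vertex of $S$; the strong metric dimension $dim_s(G)$ is the minimum cardinality of a strong resolving set. For $x\in V(G)$ and $W\subseteq V(G)$, $d_G(x,W)=\min\{d_G(x,w):w\in W\}$. A set $W$ strongly resolves two different vertices $x,y\notin W$ if $d_G(x,W)=d_G(x,y)+d_G(y,W)$ or $d_G(y,W)=d_G(y,x)+d_G(x,W)$. An ordered vertex partition $\Pi=\{U_1,\dots,U_k\}$ of $G$ is a strong resolving partition if every two different vertices of $G$ belonging to the same set of $\Pi$ are strongly resolved by some set of $\Pi$. The strong partition dimension $pd_s(G)$ is the minimum cardinality of a strong resolving partition of $G$. -}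

module Defs where

open import Data.Nat using (ℕ; zero; suc; _+_; _≤_)
open import Data.Fin using (Fin)
open import Data.Fin.Subset using (Subset; _∈_; _∉_; ∣_∣)
open import Data.Product using (Σ; ∃; ∃-syntax; _×_; _,_)
open import Data.Sum using (_⊎_)
open import Relation.Nullary using (¬_)
open import Relation.Binary.PropositionalEquality using (_≡_; _≢_)
open import Function using (Surjective)

record Graph (n : ℕ) : Set₁ where
  field
    Adj     : Fin n → Fin n → Set
    sym     : ∀ {x y} → Adj x y → Adj y x
    irrefl  : ∀ {x} → ¬ Adj x x
open Graph public

data Walk {n : ℕ} (G : Graph n) : Fin n → Fin n → ℕ → Set where
  here : ∀ {x} → Walk G x x zero
  step : ∀ {x y z k} → Adj G x y → Walk G y z k → Walk G x z (suc k)

Connected : ∀ {n} → Graph n → Set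
Connected G = ∀ x y → ∃[ k ] Walk G x y k

IsShortestPathDistance : ∀ {n} → Graph n → (Fin n → Fin n → ℕ) → Set
IsShortestPathDistance G d =
  ∀ x y → Walk G x y (d x y) × (∀ k → Walk G x y k → d x y ≤ k)

module _ {n : ℕ} (d : Fin n → Fin n → ℕ) where

  StronglyResolves : Fin n → Fin n → Fin n → Set
  StronglyResolves v x y = (d x v ≡ d x y + d y v) ⊎ (d y v ≡ d y x + d x v)

  IsStrongResolvingSet : Subset n → Set
  IsStrongResolvingSet S =
    ∀ x y → x ≢ y → ∃[ v ] (v ∈ S × StronglyResolves v x y)

  IsStrongMetricDimension : ℕ → Set
  IsStrongMetricDimension a =
    (∃[ S ] (IsStrongResolvingSet S × ∣ S ∣ ≡ a))
    × (∀ S → IsStrongResolvingSet S → a ≤ ∣ S ∣)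

  DistToSet : Fin n → (Fin n → Set) → ℕ → Set
  DistToSet x W m = (∃[ w ] (W w × d x w ≡ m)) × (∀ w → W w → m ≤ d x w)

  SetStronglyResolves : (Fin n → Set) → Fin n → Fin n → Set
  SetStronglyResolves W x y =
    ¬ W x × ¬ W y ×
    ∃[ mx ] ∃[ my ] (DistToSet x W mx × DistToSet y W my ×
                     ((mx ≡ d x y + my) ⊎ (my ≡ d y x + mx)))

  -- An ordered partition {U_0, …, U_(k-1)} of V(G) into k nonempty sets is
  -- given by the class map f : V(G) → Fin k (U_i = f⁻¹(i)); nonemptiness of
  -- every part is surjectivity of f.
  Part : ∀ {k} → (Fin n → Fin k) → Fin k → Fin n → Set
  Part f i v = f v ≡ i

  IsStrongResolvingPartition : ∀ {k} → (Fin n → Fin k) → Set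
  IsStrongResolvingPartition {k} f =
    Surjective _≡_ _≡_ f ×
    (∀ x y → x ≢ y → f x ≡ f y → ∃[ j ] SetStronglyResolves (Part f j) x y)

  IsStrongPartitionDimension : ℕ → Set
  IsStrongPartitionDimension b =
    (Σ (Fin n → Fin b) IsStrongResolvingPartition)
    × (∀ k (f : Fin n → Fin k) → IsStrongResolvingPartition f → b ≤ k)

module Submission where

-- Proof idea (the paper's): let S be a strong resolving set of minimum size
-- a = dim_s(G).  If some vertex lies outside S, partition V(G) into the
-- singletons {v} (v ∈ S) together with the rest V(G) ∖ S; these are a + 1
-- nonempty parts.  Two distinct vertices in a common part both lie in the
-- rest, and a vertex v ∈ S strongly resolving them yields the part {v},
-- whose distance to any vertex x is d x v, so {v} strongly resolves them as
-- a set.  If S = V(G), the partition into n singletons is trivially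
-- resolving and n = a.  Either way pd_s(G) ≤ a + 1.

open import Defs hiding (sym; here)
open import Data.Nat using (ℕ; zero; suc; _+_; _≤_)
open import Data.Nat.Properties using (≤-refl; m≤m+n; +-comm; module ≤-Reasoning)
open import Data.Fin using (Fin; zero; suc; fromℕ; inject₁)
open import Data.Fin.Properties using (suc-injective; all?; ¬∀⟶∃¬)
open import Data.Fin.Subset using (Subset; _∈_; _∉_; ∣_∣; inside; outside)
open import Data.Fin.Subset.Properties using (_∈?_; ⊆⊤; ⊆-antisym; ∣⊤∣≡n)
open import Data.Vec using (_∷_; here; there)
open import Data.Product using (∃-syntax; _,_)
open import Data.Sum using (_⊎_; inj₁; inj₂)
open import Function using (id; Surjective)
open import Relation.Nullary using (¬_; yes; no; contradiction)
open import Relation.Binary.PropositionalEquality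
  using (_≡_; _≢_; refl; sym; trans; cong; subst)

-- rank S sends the members of S, in order, to the classes inject₁ 0, 1, …,
-- ∣ S ∣ - 1, and every non-member to the last class fromℕ ∣ S ∣.
rank : ∀ {n} (S : Subset n) → Fin n → Fin (suc ∣ S ∣)
rank (inside  ∷ S) zero    = zero
rank (inside  ∷ S) (suc x) = suc (rank S x)
rank (outside ∷ S) zero    = fromℕ ∣ S ∣
rank (outside ∷ S) (suc x) = rank S x

rank-∉ : ∀ {n} (S : Subset n) {x} → x ∉ S → rank S x ≡ fromℕ ∣ S ∣
rank-∉ (inside  ∷ S) {zero}  x∉S = contradiction here x∉S
rank-∉ (inside  ∷ S) {suc x} x∉S = cong suc (rank-∉ S (λ x∈S → x∉S (there x∈S)))
rank-∉ (outside ∷ S) {zero}  x∉S = refl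
rank-∉ (outside ∷ S) {suc x} x∉S = rank-∉ S (λ x∈S → x∉S (there x∈S))

rank-∈ : ∀ {n} (S : Subset n) {x} → x ∈ S → rank S x ≢ fromℕ ∣ S ∣
rank-∈ (inside  ∷ S) here        ()
rank-∈ (inside  ∷ S) (there x∈S) eq = rank-∈ S x∈S (suc-injective eq)
rank-∈ (outside ∷ S) (there x∈S) eq = rank-∈ S x∈S eq

rank-injective-∈ : ∀ {n} (S : Subset n) {x y} → x ∈ S → rank S x ≡ rank S y → x ≡ y
rank-injective-∈ (inside  ∷ S) {zero}  {zero}  _           _  = refl
rank-injective-∈ (inside  ∷ S) {suc x} {suc y} (there x∈S) eq =
  cong suc (rank-injective-∈ S x∈S (suc-injective eq))
rank-injective-∈ (outside ∷ S) {suc x} {zero}  (there x∈S) eq = contradiction eq (rank-∈ S x∈S)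
rank-injective-∈ (outside ∷ S) {suc x} {suc y} (there x∈S) eq =
  cong suc (rank-injective-∈ S x∈S eq)

rank-hits-inject₁ : ∀ {n} (S : Subset n) (j : Fin ∣ S ∣) → ∃[ x ] rank S x ≡ inject₁ j
rank-hits-inject₁ (inside ∷ S) zero = zero , refl
rank-hits-inject₁ (inside ∷ S) (suc j) with rank-hits-inject₁ S j
... | x , eq = suc x , cong suc eq
rank-hits-inject₁ (outside ∷ S) j with rank-hits-inject₁ S j
... | x , eq = suc x , eq

fromℕ-or-inject₁ : ∀ {m} (i : Fin (suc m)) → i ≡ fromℕ m ⊎ ∃[ j ] i ≡ inject₁ j
fromℕ-or-inject₁ {zero}  zero    = inj₁ refl
fromℕ-or-inject₁ {suc m} zero    = inj₂ (zero , refl)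
fromℕ-or-inject₁ {suc m} (suc i) with fromℕ-or-inject₁ i
... | inj₁ eq       = inj₁ (cong suc eq)
... | inj₂ (j , eq) = inj₂ (suc j , cong suc eq)

rank-surjective : ∀ {n} (S : Subset n) {v₀} → v₀ ∉ S → Surjective _≡_ _≡_ (rank S)
rank-surjective S {v₀} v₀∉S i with fromℕ-or-inject₁ i
... | inj₁ i≡last = v₀ , λ { refl → trans (rank-∉ S v₀∉S) (sym i≡last) }
... | inj₂ (j , i≡j) with rank-hits-inject₁ S j
...   | x , eq = x , λ { refl → trans eq (sym i≡j) }

all-members⇒size : ∀ {n} (S : Subset n) → (∀ x → x ∈ S) → ∣ S ∣ ≡ n
all-members⇒size {n} S all∈S =
  trans (cong ∣_∣ (⊆-antisym ⊆⊤ (λ {x} _ → all∈S x))) (∣⊤∣≡n n)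

module _ {n : ℕ} (d : Fin n → Fin n → ℕ) where

  dist-to-singleton : ∀ {W : Fin n → Set} {v} → W v → (∀ w → W w → w ≡ v) →
                      ∀ x → DistToSet d x W (d x v)
  dist-to-singleton {v = v} v∈W only-v x =
    (v , v∈W , refl) , λ w w∈W → subst (λ u → d x v ≤ d x u) (sym (only-v w w∈W)) ≤-refl

  singleton-resolves : ∀ {W : Fin n → Set} {v x y} → W v → (∀ w → W w → w ≡ v) →
                       ¬ W x → ¬ W y → StronglyResolves d v x y → SetStronglyResolves d W x y
  singleton-resolves {v = v} {x} {y} v∈W only-v x∉W y∉W v-resolves =
    x∉W , y∉W , d x v , d y v ,
    dist-to-singleton v∈W only-v x , dist-to-singleton v∈W only-v y , v-resolves

  discrete-partition : IsStrongResolvingPartition d id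
  discrete-partition = (λ i → i , λ eq → eq) , λ x y x≢y x≡y → contradiction x≡y x≢y

  module _ (S : Subset n) (S-resolving : IsStrongResolvingSet d S)
           {v₀ : Fin n} (v₀∉S : v₀ ∉ S) where

    alone : ∀ {v} → v ∈ S → ∀ w → Part d (rank S) (rank S v) w → w ≡ v
    alone v∈S w eq = sym (rank-injective-∈ S v∈S (sym eq))

    shared⇒∉ : ∀ {x y} → x ≢ y → rank S x ≡ rank S y → x ∉ S
    shared⇒∉ x≢y eq x∈S = x≢y (rank-injective-∈ S x∈S eq)

    ∉⇒not-in-singleton : ∀ {v x} → v ∈ S → x ∉ S → ¬ Part d (rank S) (rank S v) x
    ∉⇒not-in-singleton v∈S x∉S eq = x∉S (subst (_∈ S) (sym (alone v∈S _ eq)) v∈S)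

    singletons-and-rest : IsStrongResolvingPartition d (rank S)
    singletons-and-rest = rank-surjective S v₀∉S , resolve
      where
      resolve : ∀ x y → x ≢ y → rank S x ≡ rank S y →
                ∃[ j ] SetStronglyResolves d (Part d (rank S) j) x y
      resolve x y x≢y eq with S-resolving x y x≢y
      ... | v , v∈S , v-resolves =
        rank S v ,
        singleton-resolves refl (alone v∈S)
          (∉⇒not-in-singleton v∈S (shared⇒∉ x≢y eq))
          (∉⇒not-in-singleton v∈S (shared⇒∉ (λ y≡x → x≢y (sym y≡x)) (sym eq)))
          v-resolves

theorem2 : ∀ {n : ℕ} (G : Graph n) → Connected G →
    (d : Fin n → Fin n → ℕ) → IsShortestPathDistance G d →
    ∀ a b → IsStrongMetricDimension d a → IsStrongPartitionDimension d b →
    b ≤ a + 1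
theorem2 {n} _ _ d _ a b ((S , S-resolving , ∣S∣≡a) , _) (_ , b-minimal)
  with all? (_∈? S)
... | yes all∈S = begin
  b      ≤⟨ b-minimal n id (discrete-partition d) ⟩
  n      ≡⟨ sym (all-members⇒size S all∈S) ⟩
  ∣ S ∣  ≡⟨ ∣S∣≡a ⟩
  a      ≤⟨ m≤m+n a 1 ⟩
  a + 1  ∎
  where open ≤-Reasoning
... | no ¬all∈S with ¬∀⟶∃¬ n (_∈ S) (_∈? S) ¬all∈S
...   | v₀ , v₀∉S = begin
  b          ≤⟨ b-minimal (suc ∣ S ∣) (rank S) (singletons-and-rest d S S-resolving v₀∉S) ⟩
  suc ∣ S ∣  ≡⟨ cong suc ∣S∣≡a ⟩
  suc a      ≡⟨ +-comm 1 a ⟩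
  a + 1      ∎
  where open ≤-Reasoning
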